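{- Let $G$ be a connected graph of order $n\geq 2$ and let $H$ be a graph with $k\geq 1$ connected components $H_1,\ldots,H_k$. Then $\chi_L(G\odot H)\leq \chi_L(G)+\sum_{t=1}^{k}\bigl(\chi_L(H_t+K_1)-1\bigr)$.
   Context: All graphs are finite and simple. For a connected graph $G$, a $k$-coloring is a map $c:V(G)\to\{1,\ldots,k\}$ with $c(u)\neq c(v)$ whenever $uv\in E(G)$; it induces the partition $\Pi=\{C_1,\ldots,C_k\}$ into color classes. The color code of $v$ is $c_\Pi(v)=(d(v,C_1),\ldots,d(v,C_k))$, where $d(v,C_i)=\min\{d(v,x): x\in C_i\}$. The coloring is locating if distinct vertices have distinct color codes; $\chi_L(G)$ is the least $k$ admitting a locating $k$-coloring. The corona product $G\odot H$ (for $V(G)=\{a_1,\ldots,a_n\}$) is obtained from one copy of $G$ and $n$ copies of $H$ by joining $a_i$ to every vertex of the $i$-th copy of $H$. $H_t+K_1$ denotes the join of $H_t$ with a single new vertex adjacent to all vertices of $H_t$. -}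

module Defs where

open import Level using (0ℓ)
open import Data.Nat using (ℕ; zero; suc; _≤_; _∸_; _+_)
open import Data.Fin using (Fin)
open import Data.Vec using (sum; tabulate)
open import Data.Product using (Σ; ∃; _×_; _,_; proj₁)
open import Data.Sum using (_⊎_; inj₁; inj₂)
open import Data.Maybe using (Maybe; just; nothing)
open import Data.Empty using (⊥)
open import Data.Unit using (⊤)
open import Relation.Nullary using (¬_)
open import Relation.Binary.PropositionalEquality using (_≡_; _≢_; sym)
open import Function.Bundles using (_↔_; _⇔_; Inverse)

-- A simple graph: vertex type with a symmetric irreflexive adjacency relation.
-- Finiteness is imposed separately (Finite below) on the input graphs.
record Graph : Set₁ where
  field
    V     : Set
    E     : V → V → Set
    E-sym : ∀ {u v} → E u v → E v u
    E-irr : ∀ {v} → ¬ E v v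
open Graph public

HasOrder : Graph → ℕ → Set
HasOrder G n = V G ↔ Fin n

Finite : Graph → Set
Finite G = ∃ λ n → HasOrder G n

data Walk (G : Graph) : V G → V G → ℕ → Set where
  here : ∀ {u} → Walk G u u zero
  step : ∀ {u w v ℓ} → E G u w → Walk G w v ℓ → Walk G u v (suc ℓ)

Connected : Graph → Set
Connected G = ∀ u v → ∃ λ ℓ → Walk G u v ℓ

DistToClass : (G : Graph) {k : ℕ} → (V G → Fin k) → V G → Fin k → ℕ → Set
DistToClass G c v i d =
  (∃ λ x → c x ≡ i × Walk G v x d) ×
  (∀ x d' → c x ≡ i → Walk G v x d' → d ≤ d')

SameCode : (G : Graph) {k : ℕ} → (V G → Fin k) → V G → V G → Set
SameCode G c u v = ∀ i d → (DistToClass G c u i d → DistToClass G c v i d)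
                          × (DistToClass G c v i d → DistToClass G c u i d)

record LocatingColoring (G : Graph) (k : ℕ) : Set where
  field
    col      : V G → Fin k
    proper   : ∀ {u v} → E G u v → col u ≢ col v
    onto     : ∀ i → ∃ λ v → col v ≡ i
    locating : ∀ u v → SameCode G col u v → u ≡ v

ChiL : Graph → ℕ → Set
ChiL G k = LocatingColoring G k × (∀ j → LocatingColoring G j → k ≤ j)

-- Corona product G ⊙ H: vertices a (of G) and (a , h) (vertex h in the copy of H at a).
CoronaE : (G H : Graph) → V G ⊎ (V G × V H) → V G ⊎ (V G × V H) → Set
CoronaE G H (inj₁ a) (inj₁ b) = E G a b
CoronaE G H (inj₁ a) (inj₂ (b , h)) = a ≡ b
CoronaE G H (inj₂ (a , h)) (inj₁ b) = a ≡ b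
CoronaE G H (inj₂ (a , h)) (inj₂ (b , h')) = a ≡ b × E H h h'

corona-sym : (G H : Graph) → ∀ {u v} → CoronaE G H u v → CoronaE G H v u
corona-sym G H {inj₁ a} {inj₁ b} e = E-sym G e
corona-sym G H {inj₁ a} {inj₂ (b , h)} e = sym e
corona-sym G H {inj₂ (a , h)} {inj₁ b} e = sym e
corona-sym G H {inj₂ (a , h)} {inj₂ (b , h')} (Relation.Binary.PropositionalEquality.refl , e) =
  Relation.Binary.PropositionalEquality.refl , E-sym H e

corona-irr : (G H : Graph) → ∀ {v} → ¬ CoronaE G H v v
corona-irr G H {inj₁ a} e = E-irr G e
corona-irr G H {inj₂ (a , h)} (_ , e) = E-irr H e

_⊙_ : Graph → Graph → Graph
G ⊙ H = record
  { V = V G ⊎ (V G × V H)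
  ; E = CoronaE G H
  ; E-sym = λ {u} {v} → corona-sym G H {u} {v}
  ; E-irr = λ {v} → corona-irr G H {v}
  }

-- Join H + K₁: new vertex 'nothing' adjacent to every vertex of H.
JoinE : (H : Graph) → Maybe (V H) → Maybe (V H) → Set
JoinE H nothing nothing = ⊥
JoinE H nothing (just _) = ⊤
JoinE H (just _) nothing = ⊤
JoinE H (just x) (just y) = E H x y

join-sym : (H : Graph) → ∀ {u v} → JoinE H u v → JoinE H v u
join-sym H {nothing} {just _} e = e
join-sym H {just _} {nothing} e = e
join-sym H {just x} {just y} e = E-sym H e

join-irr : (H : Graph) → ∀ {v} → ¬ JoinE H v v
join-irr H {nothing} ()
join-irr H {just x} e = E-irr H e

_+K₁ : Graph → Graph
H +K₁ = record
  { V = Maybe (V H)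
  ; E = JoinE H
  ; E-sym = λ {u} {v} → join-sym H {u} {v}
  ; E-irr = λ {v} → join-irr H {v}
  }

record Components (H : Graph) (k : ℕ) (Hc : Fin k → Graph) : Set₁ where
  field
    comp       : V H → Fin k
    comp-edge  : ∀ {u v} → E H u v → comp u ≡ comp v
    nonempty   : ∀ t → V (Hc t)
    connected  : ∀ t → Connected (Hc t)
    iso        : ∀ t → V (Hc t) ↔ Σ (V H) (λ h → comp h ≡ t)
    iso-adj    : ∀ t x y →
                 E (Hc t) x y ⇔ E H (proj₁ (Inverse.to (iso t) x)) (proj₁ (Inverse.to (iso t) y))

ΣFin : (k : ℕ) → (Fin k → ℕ) → ℕ
ΣFin k f = sum (tabulate f)

-- Colour the base vertices of G ⊙ H by a locating colouring f of G, and a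
-- vertex of the copy of H at u lying in the component H_t by the colour it
-- gets under a locating colouring g_t of H_t + K₁ with u playing the apex.
-- Each component reuses its own colours except the apex colour, giving
-- a + Σ_t (χ_L(H_t + K₁) − 1) colours in total.  Distances from a copy
-- vertex to base colours are one more than the corresponding distances in G,
-- so two vertices with the same code sit over the same base vertex (f is
-- locating); within a copy, distances to the colours of H_t are those in
-- H_t + K₁ (any walk leaving the copy projects onto the apex), while the
-- apex colour is at distance one from every copy vertex, so g_t locates.
module Submission where

open import Defs
open import Data.Nat using (ℕ; zero; suc; _≤_; _+_; _∸_; z≤n; s≤s)
open import Data.Nat.Properties using (≤-refl; ≤-trans; ≤-antisym; n≤1+n; +-monoʳ-≤; +-cancelˡ-≤)
open import Data.Fin using (Fin; zero; suc; punchIn; punchOut) renaming (_≟_ to _≟ᶠ_)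
open import Data.Fin.Properties using (+↔⊎; punchOut-cong; punchOut-injective; punchOut-punchIn; punchInᵢ≢i)
open import Data.Product using (Σ; ∃; ∃-syntax; _×_; _,_; proj₁; proj₂)
open import Data.Sum using (_⊎_; inj₁; inj₂)
open import Data.Sum.Properties using (inj₁-injective)
open import Data.Sum.Function.Propositional using (_⊎-↔_)
open import Data.Maybe using (Maybe; just; nothing)
open import Data.Maybe.Properties using (just-injective)
open import Data.Unit using (tt)
open import Data.Empty using (⊥; ⊥-elim)
open import Function using (_∘_)
open import Function.Bundles using (Inverse; Injection; Equivalence; _↔_; _⇔_; mk⇔; mk↔ₛ′)
open import Function.Properties.Inverse using (↔-refl; ↔-sym; ↔⇒↣)
open import Function.Construct.Composition using (_↔-∘_; _⇔-∘_)
open import Function.Construct.Symmetry using (⇔-sym)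
open import Relation.Nullary using (yes; no)
open import Relation.Binary.PropositionalEquality
  using (_≡_; _≢_; refl; sym; trans; cong; subst; subst₂; module ≡-Reasoning)
open ≡-Reasoning

WeakHom : (A B : Graph) → (V A → V B) → Set
WeakHom A B φ = ∀ {x y} → E A x y → E B (φ x) (φ y) ⊎ φ x ≡ φ y

WalkAtMost : (G : Graph) → V G → V G → ℕ → Set
WalkAtMost G x y ℓ = ∃[ ℓ' ] Walk G x y ℓ' × ℓ' ≤ ℓ

walk-map : ∀ {A B} (φ : V A → V B) → WeakHom A B φ →
           ∀ {x y ℓ} → Walk A x y ℓ → WalkAtMost B (φ x) (φ y) ℓ
walk-map φ hom here = 0 , here , z≤n
walk-map {B = B} φ hom {y = y} (step e w) with walk-map φ hom w | hom e
... | ℓ , w' , ℓ≤ | inj₁ e' = suc ℓ , step e' w' , s≤s ℓ≤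
... | ℓ , w' , ℓ≤ | inj₂ φx≡φy =
  ℓ , subst (λ z → Walk B z (φ y) ℓ) (sym φx≡φy) w' , ≤-trans ℓ≤ (n≤1+n _)

Reach : (G : Graph) → (V G → Set) → V G → ℕ → Set
Reach G P v ℓ = ∃[ x ] P x × Walk G v x ℓ

-- Shaped so that DistToClass G c v i is DistTo G (λ x → c x ≡ i) v by definition.
DistTo : (G : Graph) → (V G → Set) → V G → ℕ → Set
DistTo G P v d = Reach G P v d × (∀ x ℓ → P x → Walk G v x ℓ → d ≤ ℓ)

DistTo-shift : ∀ {A B P Q u u'} (s : ℕ) →
  (∀ {ℓ} → Reach A P u ℓ → ∃[ ℓ' ] Reach B Q u' ℓ' × ℓ' ≤ s + ℓ) →
  (∀ {ℓ'} → Reach B Q u' ℓ' → ∃[ ℓ ] Reach A P u ℓ × s + ℓ ≤ ℓ') →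
  ∀ {d} → DistTo A P u d ⇔ DistTo B Q u' (s + d)
DistTo-shift {A} {B} {P} {Q} {u} {u'} s up down {d} = mk⇔ forth back
  where
  forth : DistTo A P u d → DistTo B Q u' (s + d)
  forth (r , minimal) with up r
  ... | ℓ' , r' , ℓ'≤ = subst (Reach B Q u') (≤-antisym ℓ'≤ (bound r')) r'
                      , λ y m qy w → bound (y , qy , w)
    where
    bound : ∀ {m} → Reach B Q u' m → s + d ≤ m
    bound r'' with down r''
    ... | ℓ , (x , px , w) , s+ℓ≤ = ≤-trans (+-monoʳ-≤ s (minimal x ℓ px w)) s+ℓ≤
  back : DistTo B Q u' (s + d) → DistTo A P u d
  back (r , minimal) with down r
  ... | ℓ , r' , s+ℓ≤ = subst (Reach A P u) (≤-antisym (+-cancelˡ-≤ s _ _ s+ℓ≤) (bound r')) r'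
                      , λ x m px w → bound (x , px , w)
    where
    bound : ∀ {m} → Reach A P u m → d ≤ m
    bound {m} r'' with up r''
    ... | ℓ' , (y , qy , w) , ℓ'≤ = +-cancelˡ-≤ s d m (≤-trans (minimal y ℓ' qy w) ℓ'≤)

DistTo-resp : ∀ {G P Q v} → (∀ {x} → P x → Q x) → (∀ {x} → Q x → P x) →
              ∀ {d} → DistTo G P v d ⇔ DistTo G Q v d
DistTo-resp P⇒Q Q⇒P =
  DistTo-shift 0 (λ { (x , px , w) → _ , (x , P⇒Q px , w) , ≤-refl })
                 (λ { (x , qx , w) → _ , (x , Q⇒P qx , w) , ≤-refl })

DistTo-unique : ∀ {G P v d d'} → DistTo G P v d → DistTo G P v d' → d ≡ d'
DistTo-unique ((x , px , w) , minimal) ((x' , px' , w') , minimal') =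
  ≤-antisym (minimal x' _ px' w') (minimal' x _ px w)

DistTo-zero : ∀ {G P v} → P v → DistTo G P v 0
DistTo-zero pv = (_ , pv , here) , λ _ _ _ _ → z≤n

DistTo-zero⁻¹ : ∀ {G P v} → DistTo G P v 0 → P v
DistTo-zero⁻¹ ((_ , px , here) , _) = px

DistTo-equidistant : ∀ {G P u v d₀} → DistTo G P u d₀ → DistTo G P v d₀ →
                     ∀ {d} → DistTo G P u d ⇔ DistTo G P v d
DistTo-equidistant {G} {P} {u} {v} Du Dv =
  mk⇔ (λ D → subst (DistTo G P v) (DistTo-unique Du D) Dv)
      (λ D → subst (DistTo G P u) (DistTo-unique Dv D) Du)

SameCodeBy : (G : Graph) {T : Set} → (V G → T) → V G → V G → Set
SameCodeBy G c u v = ∀ τ d → DistTo G (λ x → c x ≡ τ) u d ⇔ DistTo G (λ x → c x ≡ τ) v d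

SameCodeBy⇒SameCode : ∀ {G k} {c : V G → Fin k} {u v} → SameCodeBy G c u v → SameCode G c u v
SameCodeBy⇒SameCode same i d = Equivalence.to (same i d) , Equivalence.from (same i d)

SameCodeBy⇒sameColour : ∀ {G T} {c : V G → T} {u v} → SameCodeBy G c u v → c u ≡ c v
SameCodeBy⇒sameColour {c = c} {u} same =
  sym (DistTo-zero⁻¹ (Equivalence.to (same (c u) 0) (DistTo-zero refl)))

locatingColouring : ∀ {G T N} (e : T ↔ Fin N) (c : V G → T) →
  (∀ {u v} → E G u v → c u ≢ c v) → (∀ τ → ∃ λ v → c v ≡ τ) →
  (∀ u v → SameCodeBy G c u v → u ≡ v) → LocatingColoring G N
locatingColouring {G} e c proper onto locating = record
  { col      = to ∘ c
  ; proper   = λ uv eq → proper uv (to-injective eq)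
  ; onto     = λ i → proj₁ (onto (from i)) , trans (cong to (proj₂ (onto (from i)))) (strictlyInverseˡ i)
  ; locating = λ u v same → locating u v λ τ d →
      ⇔-sym (recoloured τ) ⇔-∘ (mk⇔ (proj₁ (same (to τ) d)) (proj₂ (same (to τ) d)) ⇔-∘ recoloured τ)
  }
  where
  open Inverse e
  to-injective : ∀ {τ τ'} → to τ ≡ to τ' → τ ≡ τ'
  to-injective = Injection.injective (↔⇒↣ e)
  recoloured : ∀ τ {x d} → DistTo G (λ y → c y ≡ τ) x d ⇔ DistTo G (λ y → to (c y) ≡ to τ) x d
  recoloured τ = DistTo-resp (cong to) to-injective

Σ-Fin-suc↔⊎ : ∀ {k} (f : Fin (suc k) → ℕ) →
              Σ (Fin (suc k)) (Fin ∘ f) ↔ (Fin (f zero) ⊎ Σ (Fin k) (Fin ∘ f ∘ suc))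
Σ-Fin-suc↔⊎ f = mk↔ₛ′
  (λ { (zero , r) → inj₁ r ; (suc t , r) → inj₂ (t , r) })
  (λ { (inj₁ r) → zero , r ; (inj₂ (t , r)) → suc t , r })
  (λ { (inj₁ r) → refl ; (inj₂ (t , r)) → refl })
  (λ { (zero , r) → refl ; (suc t , r) → refl })

ΣFin↔Σ : ∀ k (f : Fin k → ℕ) → Fin (ΣFin k f) ↔ Σ (Fin k) (Fin ∘ f)
ΣFin↔Σ zero    f = mk↔ₛ′ (λ ()) (λ { (() , _) }) (λ { (() , _) }) (λ ())
ΣFin↔Σ (suc k) f = ↔-sym (Σ-Fin-suc↔⊎ f) ↔-∘ ((↔-refl ⊎-↔ ΣFin↔Σ k (f ∘ suc)) ↔-∘ +↔⊎)

dropAt : ∀ {m} (α j : Fin m) → j ≢ α → Fin (m ∸ 1)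
dropAt {suc m} α j j≢α = punchOut (j≢α ∘ sym)

dropAt-injective : ∀ {m} (α : Fin m) {j j'} (p : j ≢ α) (p' : j' ≢ α) →
                   dropAt α j p ≡ dropAt α j' p' → j ≡ j'
dropAt-injective {suc m} α p p' = punchOut-injective (p ∘ sym) (p' ∘ sym)

dropAt-cong : ∀ {m} (α : Fin m) {j j'} (p : j ≢ α) (p' : j' ≢ α) →
              j ≡ j' → dropAt α j p ≡ dropAt α j' p'
dropAt-cong {suc m} α p p' = punchOut-cong α

dropAt-surjective : ∀ {m} (α : Fin m) r → ∃[ j ] Σ (j ≢ α) λ p → dropAt α j p ≡ r
dropAt-surjective {suc m} α r =
  punchIn α r , punchInᵢ≢i α r , trans (punchOut-cong α refl) (punchOut-punchIn α)

module Corona (G H : Graph) where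

  base : V (G ⊙ H) → V G
  base (inj₁ v)       = v
  base (inj₂ (v , _)) = v

  depth : V (G ⊙ H) → ℕ
  depth (inj₁ _) = 0
  depth (inj₂ _) = 1

  OnBase : (V G → Set) → V (G ⊙ H) → Set
  OnBase P (inj₁ v) = P v
  OnBase P (inj₂ _) = ⊥

  base-weakHom : WeakHom (G ⊙ H) G base
  base-weakHom {inj₁ _} {inj₁ _} e       = inj₁ e
  base-weakHom {inj₁ _} {inj₂ _} e       = inj₂ e
  base-weakHom {inj₂ _} {inj₁ _} e       = inj₂ e
  base-weakHom {inj₂ _} {inj₂ _} (e , _) = inj₂ e

  walk-to-base : ∀ {x y ℓ} → Walk (G ⊙ H) x (inj₁ y) ℓ →
                 ∃[ ℓ' ] Walk G (base x) y ℓ' × depth x + ℓ' ≤ ℓ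
  walk-to-base {inj₁ _} w = walk-map base (λ {x} {y} → base-weakHom {x} {y}) w
  walk-to-base {inj₂ _} (step {w = x} e w) with walk-map base (λ {x} {y} → base-weakHom {x} {y}) w
  ... | ℓ' , w' , ℓ'≤ = ℓ' , subst (λ z → Walk G z _ ℓ') (base-step {w = x} e) w' , s≤s ℓ'≤
    where
    base-step : ∀ {u h} {w} → CoronaE G H (inj₂ (u , h)) w → base w ≡ u
    base-step {w = inj₁ _} e       = sym e
    base-step {w = inj₂ _} (e , _) = sym e

  walk-from-base : ∀ x {y ℓ} → Walk G (base x) y ℓ →
                   ∃[ ℓ' ] Walk (G ⊙ H) x (inj₁ y) ℓ' × ℓ' ≤ depth x + ℓ
  walk-from-base (inj₁ _) w = walk-map {B = G ⊙ H} inj₁ inj₁ w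
  walk-from-base (inj₂ _) w with walk-map {B = G ⊙ H} inj₁ inj₁ w
  ... | ℓ' , w' , ℓ'≤ = suc ℓ' , step refl w' , s≤s ℓ'≤

  base-distance : ∀ {P} x {d} → DistTo G P (base x) d ⇔ DistTo (G ⊙ H) (OnBase P) x (depth x + d)
  base-distance x = DistTo-shift (depth x) up down
    where
    up : ∀ {P ℓ} → Reach G P (base x) ℓ → ∃[ ℓ' ] Reach (G ⊙ H) (OnBase P) x ℓ' × ℓ' ≤ depth x + ℓ
    up (y , py , w) with walk-from-base x w
    ... | ℓ' , w' , ℓ'≤ = ℓ' , (inj₁ y , py , w') , ℓ'≤
    down : ∀ {P ℓ'} → Reach (G ⊙ H) (OnBase P) x ℓ' → ∃[ ℓ ] Reach G P (base x) ℓ × depth x + ℓ ≤ ℓ'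
    down (inj₁ y , py , w) with walk-to-base w
    ... | ℓ , w' , ≤ℓ' = ℓ , (y , py , w') , ≤ℓ'

module Copies (G H : Graph) {k : ℕ} {Hc : Fin k → Graph} (CH : Components H k Hc) where
  open Components CH

  embed : Σ (Fin k) (V ∘ Hc) → V H
  embed (t , z) = proj₁ (Inverse.to (iso t) z)

  component : V H → Σ (Fin k) (V ∘ Hc)
  component h = comp h , Inverse.from (iso (comp h)) (h , refl)

  component-≡ : ∀ h {t} (p : comp h ≡ t) → component h ≡ (t , Inverse.from (iso t) (h , p))
  component-≡ h refl = refl

  embed-from : ∀ t s → embed (t , Inverse.from (iso t) s) ≡ proj₁ s
  embed-from t s = cong proj₁ (Inverse.strictlyInverseˡ (iso t) s)

  embed-component : ∀ h → embed (component h) ≡ h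
  embed-component h = embed-from (comp h) (h , refl)

  component-embed : ∀ p → component (embed p) ≡ p
  component-embed (t , z) =
    trans (component-≡ _ (proj₂ (Inverse.to (iso t) z))) (cong (t ,_) (Inverse.strictlyInverseʳ (iso t) z))

  data ComponentEdge : Σ (Fin k) (V ∘ Hc) → Σ (Fin k) (V ∘ Hc) → Set where
    edge : ∀ {t z z'} → E (Hc t) z z' → ComponentEdge (t , z) (t , z')

  component-edge : ∀ {h h'} → E H h h' → ComponentEdge (component h) (component h')
  component-edge {h} {h'} e =
    subst (ComponentEdge (component h)) (sym (component-≡ h' h'∈t)) (edge (Equivalence.from (iso-adj t _ _)
      (subst₂ (E H) (sym (embed-from t (h , refl))) (sym (embed-from t (h' , h'∈t))) e)))
    where
    t : Fin k
    t = comp h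
    h'∈t : comp h' ≡ t
    h'∈t = sym (comp-edge e)

  restrict : (t : Fin k) → Σ (Fin k) (V ∘ Hc) → Maybe (V (Hc t))
  restrict t (t' , z) with t' ≟ᶠ t
  ... | yes refl = just z
  ... | no _     = nothing

  restrict-self : ∀ t z → restrict t (t , z) ≡ just z
  restrict-self t z with t ≟ᶠ t
  ... | yes refl = refl
  ... | no t≢t   = ⊥-elim (t≢t refl)

  restrict-edge : ∀ t {p q} → ComponentEdge p q →
                  JoinE (Hc t) (restrict t p) (restrict t q) ⊎ restrict t p ≡ restrict t q
  restrict-edge t (edge {t'} e) with t' ≟ᶠ t
  ... | yes refl = inj₁ e
  ... | no _     = inj₂ refl

  copyAt : V G → (t : Fin k) → V (Hc t +K₁) → V (G ⊙ H)
  copyAt u t nothing  = inj₁ u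
  copyAt u t (just z) = inj₂ (u , embed (t , z))

  copyAt-weakHom : ∀ u t → WeakHom (Hc t +K₁) (G ⊙ H) (copyAt u t)
  copyAt-weakHom u t {nothing} {just _}  _ = inj₁ refl
  copyAt-weakHom u t {just _}  {nothing} _ = inj₁ refl
  copyAt-weakHom u t {just z}  {just z'} e = inj₁ (refl , Equivalence.to (iso-adj t z z') e)

  projectTo : (t : Fin k) → V (G ⊙ H) → V (Hc t +K₁)
  projectTo t (inj₁ _)       = nothing
  projectTo t (inj₂ (_ , h)) = restrict t (component h)

  projectTo-weakHom : ∀ t → WeakHom (G ⊙ H) (Hc t +K₁) (projectTo t)
  projectTo-weakHom t {inj₁ _}       {inj₁ _}       _       = inj₂ refl
  projectTo-weakHom t {inj₁ _}       {inj₂ (_ , h)} _       = from-apex (restrict t (component h))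
    where
    from-apex : ∀ m → JoinE (Hc t) nothing m ⊎ nothing ≡ m
    from-apex nothing  = inj₂ refl
    from-apex (just _) = inj₁ tt
  projectTo-weakHom t {inj₂ (_ , h)} {inj₁ _}       _       = to-apex (restrict t (component h))
    where
    to-apex : ∀ m → JoinE (Hc t) m nothing ⊎ m ≡ nothing
    to-apex nothing  = inj₂ refl
    to-apex (just _) = inj₁ tt
  projectTo-weakHom t {inj₂ _}       {inj₂ _}       (_ , e) = restrict-edge t (component-edge e)

  projectTo-copyAt : ∀ u t x → projectTo t (copyAt u t x) ≡ x
  projectTo-copyAt u t nothing  = refl
  projectTo-copyAt u t (just z) = trans (cong (restrict t) (component-embed (t , z))) (restrict-self t z)

  copy-distance : ∀ u t z {P Q} →
                  (∀ {y} → P y → Q (copyAt u t y)) → (∀ {x} → Q x → P (projectTo t x)) →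
                  ∀ {d} → DistTo (Hc t +K₁) P (just z) d ⇔ DistTo (G ⊙ H) Q (copyAt u t (just z)) d
  copy-distance u t z {P} {Q} P⇒Q Q⇒P = DistTo-shift 0 up down
    where
    up : ∀ {ℓ} → Reach (Hc t +K₁) P (just z) ℓ → ∃[ ℓ' ] Reach (G ⊙ H) Q (copyAt u t (just z)) ℓ' × ℓ' ≤ ℓ
    up (y , py , w) with walk-map (copyAt u t) (λ {x} {y} → copyAt-weakHom u t {x} {y}) w
    ... | ℓ' , w' , ℓ'≤ = ℓ' , (copyAt u t y , P⇒Q py , w') , ℓ'≤
    down : ∀ {ℓ'} → Reach (G ⊙ H) Q (copyAt u t (just z)) ℓ' → ∃[ ℓ ] Reach (Hc t +K₁) P (just z) ℓ × ℓ ≤ ℓ'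
    down (x , qx , w) with walk-map (projectTo t) (λ {x} {y} → projectTo-weakHom t {x} {y}) w
    ... | ℓ , w' , ℓ≤ =
      ℓ , (projectTo t x , Q⇒P qx , subst (λ s → Walk (Hc t +K₁) s _ ℓ) (projectTo-copyAt u t (just z)) w')
        , ℓ≤

module CoronaColouring (G H : Graph) {k : ℕ} {Hc : Fin k → Graph} (CH : Components H k Hc)
  {a : ℕ} (f : LocatingColoring G a) {b : Fin k → ℕ} (g : ∀ t → LocatingColoring (Hc t +K₁) (b t)) where
  open Corona G H
  open Copies G H CH
  open LocatingColoring

  Colour : Set
  Colour = Fin a ⊎ Σ (Fin k) (λ t → Fin (b t ∸ 1))

  apex : (t : Fin k) → Fin (b t)
  apex t = col (g t) nothing

  copyColour : Σ (Fin k) (V ∘ Hc) → Colour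
  copyColour (t , z) = inj₂ (t , dropAt (apex t) (col (g t) (just z)) (proper (g t) tt))

  colour : V (G ⊙ H) → Colour
  colour (inj₁ v)       = inj₁ (col f v)
  colour (inj₂ (_ , h)) = copyColour (component h)

  colour-copyAt : ∀ u t z → colour (copyAt u t (just z)) ≡ copyColour (t , z)
  colour-copyAt u t z = cong copyColour (component-embed (t , z))

  class-component : ∀ {t t' x y} → _≡_ {A = Colour} (inj₂ (t , x)) (inj₂ (t' , y)) → t ≡ t'
  class-component refl = refl

  class-colour : ∀ {t x y} → _≡_ {A = Colour} (inj₂ (t , x)) (inj₂ (t , y)) → x ≡ y
  class-colour refl = refl

  colour-proper : ∀ {x y} → E (G ⊙ H) x y → colour x ≢ colour y
  colour-proper {inj₁ _} {inj₁ _} e     eq = proper f e (inj₁-injective eq)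
  colour-proper {inj₁ _} {inj₂ _} _     ()
  colour-proper {inj₂ _} {inj₁ _} _     ()
  colour-proper {inj₂ _} {inj₂ _} (_ , e)  = copyColour-proper (component-edge e)
    where
    copyColour-proper : ∀ {p q} → ComponentEdge p q → copyColour p ≢ copyColour q
    copyColour-proper (edge {t} {z} {z'} e') eq =
      proper (g t) {just z} {just z'} e' (dropAt-injective (apex t) _ _ (class-colour eq))

  colour-onto : V G → ∀ τ → ∃ λ x → colour x ≡ τ
  colour-onto u (inj₁ i) = inj₁ (proj₁ (onto f i)) , cong inj₁ (proj₂ (onto f i))
  colour-onto u (inj₂ (t , r)) with dropAt-surjective (apex t) r
  ... | j , j≢apex , drop≡r with onto (g t) j
  ...   | nothing , apex≡j = ⊥-elim (j≢apex (sym apex≡j))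
  ...   | just z  , gz≡j   = copyAt u t (just z) , trans (colour-copyAt u t z)
          (cong (λ s → inj₂ (t , s)) (trans (dropAt-cong (apex t) _ _ gz≡j) drop≡r))

  base-class-distance : ∀ x i {d} →
    DistTo G (λ v → col f v ≡ i) (base x) d ⇔ DistTo (G ⊙ H) (λ y → colour y ≡ inj₁ i) x (depth x + d)
  base-class-distance x i = DistTo-resp (onBase⇒class _) (class⇒onBase _) ⇔-∘ base-distance x
    where
    onBase⇒class : ∀ y → OnBase (λ v → col f v ≡ i) y → colour y ≡ inj₁ i
    onBase⇒class (inj₁ _) = cong inj₁
    class⇒onBase : ∀ y → colour y ≡ inj₁ i → OnBase (λ v → col f v ≡ i) y
    class⇒onBase (inj₁ _) = inj₁-injective

  base-sameCode : ∀ {x y} → depth x ≡ depth y → SameCodeBy (G ⊙ H) colour x y →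
                  SameCode G (col f) (base x) (base y)
  base-sameCode {x} {y} depth≡ same = SameCodeBy⇒SameCode λ i d →
    ⇔-sym (base-class-distance y i) ⇔-∘
      (subst (λ δ → DistTo (G ⊙ H) _ x (depth x + d) ⇔ DistTo (G ⊙ H) _ y (δ + d)) depth≡
             (same (inj₁ i) (depth x + d))
       ⇔-∘ base-class-distance x i)

  apex-distance : ∀ t z → DistTo (Hc t +K₁) (λ y → col (g t) y ≡ apex t) (just z) 1
  apex-distance t z = (nothing , refl , step tt here) , minimal
    where
    minimal : ∀ y ℓ → col (g t) y ≡ apex t → Walk (Hc t +K₁) (just z) y ℓ → 1 ≤ ℓ
    minimal _ _ gz≡apex here = ⊥-elim (proper (g t) tt gz≡apex)
    minimal _ _ _ (step _ _) = s≤s z≤n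

  leaf-distance : ∀ u t z j (j≢apex : j ≢ apex t) {d} →
    DistTo (Hc t +K₁) (λ y → col (g t) y ≡ j) (just z) d ⇔
    DistTo (G ⊙ H) (λ x → colour x ≡ inj₂ (t , dropAt (apex t) j j≢apex)) (copyAt u t (just z)) d
  leaf-distance u t z j j≢apex = copy-distance u t z into out-of
    where
    into : ∀ {y} → col (g t) y ≡ j → colour (copyAt u t y) ≡ inj₂ (t , dropAt (apex t) j j≢apex)
    into {nothing} apex≡j = ⊥-elim (j≢apex (sym apex≡j))
    into {just y}  gy≡j   = trans (colour-copyAt u t y) (cong (λ s → inj₂ (t , s)) (dropAt-cong (apex t) _ _ gy≡j))
    class-of : ∀ p → copyColour p ≡ inj₂ (t , dropAt (apex t) j j≢apex) → col (g t) (restrict t p) ≡ j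
    class-of (t' , z') eq with class-component eq
    ... | refl = trans (cong (col (g t)) (restrict-self t z')) (dropAt-injective (apex t) _ _ (class-colour eq))
    out-of : ∀ {x} → colour x ≡ inj₂ (t , dropAt (apex t) j j≢apex) → col (g t) (projectTo t x) ≡ j
    out-of {inj₂ (_ , h)} = class-of (component h)

  copy-sameCode : ∀ u t z z' → SameCodeBy (G ⊙ H) colour (copyAt u t (just z)) (copyAt u t (just z')) →
                  SameCode (Hc t +K₁) (col (g t)) (just z) (just z')
  copy-sameCode u t z z' same = SameCodeBy⇒SameCode same-in-copy
    where
    same-in-copy : SameCodeBy (Hc t +K₁) (col (g t)) (just z) (just z')
    same-in-copy j d with j ≟ᶠ apex t
    ... | yes refl    = DistTo-equidistant (apex-distance t z) (apex-distance t z')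
    ... | no j≢apex = ⇔-sym (leaf-distance u t z' j j≢apex) ⇔-∘ (same _ d ⇔-∘ leaf-distance u t z j j≢apex)

  component-locating : ∀ u p q → SameCodeBy (G ⊙ H) colour (inj₂ (u , embed p)) (inj₂ (u , embed q)) → p ≡ q
  component-locating u (t , z) (t' , z') same
    with class-component (trans (sym (colour-copyAt u t z)) (trans (SameCodeBy⇒sameColour same) (colour-copyAt u t' z')))
  ... | refl = cong (t ,_) (just-injective (locating (g t) (just z) (just z') (copy-sameCode u t z z' same)))

  copy-locating : ∀ u h h' → SameCodeBy (G ⊙ H) colour (inj₂ (u , h)) (inj₂ (u , h')) → h ≡ h'
  copy-locating u h h' same = begin
    h                     ≡⟨ embed-component h ⟨
    embed (component h)   ≡⟨ cong embed (component-locating u _ _ same′) ⟩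
    embed (component h')  ≡⟨ embed-component h' ⟩
    h'                    ∎
    where
    same′ : SameCodeBy (G ⊙ H) colour (inj₂ (u , embed (component h))) (inj₂ (u , embed (component h')))
    same′ = subst₂ (λ s s' → SameCodeBy (G ⊙ H) colour (inj₂ (u , s)) (inj₂ (u , s')))
                   (sym (embed-component h)) (sym (embed-component h')) same

  colour-locating : ∀ x y → SameCodeBy (G ⊙ H) colour x y → x ≡ y
  colour-locating (inj₁ u) (inj₁ v) same = cong inj₁ (locating f u v (base-sameCode refl same))
  colour-locating (inj₁ _) (inj₂ _) same with SameCodeBy⇒sameColour same
  ... | ()
  colour-locating (inj₂ _) (inj₁ _) same with SameCodeBy⇒sameColour same
  ... | ()
  colour-locating (inj₂ (u , h)) (inj₂ (v , h')) same = over-same-base (locating f u v (base-sameCode refl same)) same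
    where
    over-same-base : ∀ {v h'} → u ≡ v → SameCodeBy (G ⊙ H) colour (inj₂ (u , h)) (inj₂ (v , h')) →
                     inj₂ (u , h) ≡ inj₂ (v , h')
    over-same-base {h' = h'} refl same = cong (λ h → inj₂ (u , h)) (copy-locating u h h' same)

  corona-locatingColouring : V G → LocatingColoring (G ⊙ H) (a + ΣFin k (λ t → b t ∸ 1))
  corona-locatingColouring u =
    locatingColouring (↔-sym ((↔-refl ⊎-↔ ΣFin↔Σ k (λ t → b t ∸ 1)) ↔-∘ +↔⊎))
    colour (λ {x} {y} → colour-proper {x} {y}) (colour-onto u) colour-locating

lemma4 : (G H : Graph) (n : ℕ) → 2 ≤ n → HasOrder G n → Connected G →
         Finite H → (k : ℕ) → 1 ≤ k → (Hc : Fin k → Graph) → Components H k Hc →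
         (a : ℕ) → ChiL G a → (b : Fin k → ℕ) → (∀ t → ChiL (Hc t +K₁) (b t)) →
         (c : ℕ) → ChiL (G ⊙ H) c →
         c ≤ a + ΣFin k (λ t → b t ∸ 1)
lemma4 G H _ (s≤s _) order _ _ k _ Hc CH a (f , _) b g c (_ , minimal) =
  minimal _ (CoronaColouring.corona-locatingColouring G H CH f (proj₁ ∘ g) (Inverse.from order zero))
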